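{- Let $L = C_0 ]_{a_1}^{b_1} C_1 \cdots ]_{a_k}^{b_k} C_k$ be a finite lattice written as an iterated adjunct sum of finite chains $C_0, C_1, \ldots, C_k$, where $C_0$ is a maximal chain of $L$ containing all the reducible elements of $L$. Then $\operatorname{Dim}(L) \leq \operatorname{Dim}(L \setminus C_i) + 1$ for all $i$, $1 \leq i \leq k$.
   Context: Adjunct sum: for disjoint lattices $L_1,L_2$ and $a<b$ in $L_1$ with $a \not\prec b$, $L_1 ]^b_a L_2$ is the set $L_1 \cup L_2$ with $x \leq y$ iff either $x,y\in L_1$ and $x\leq y$ in $L_1$; or $x,y\in L_2$ and $x\leq y$ in $L_2$; or $x\in L_1$, $y\in L_2$ and $x \leq a$ in $L_1$; or $x \in L_2$, $y \in L_1$ and $b \leq y$ in $L_1$. The iterated expression is evaluated left to right. An element is doubly irreducible if it has at most one lower cover and at most one upper cover; it is reducible otherwise. $L \setminus C_i$ is the subposet of $L$ on the complement of $C_i$. The dimension $\operatorname{Dim}(P)$ of a finite poset $P$ is the least number of linear extensions of its order whose intersection is exactly its order. -}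

module Defs where

open import Data.Nat using (ℕ; zero; suc; _≡ᵇ_)
open import Data.Fin using (Fin)
import Data.Fin as F
open import Data.Bool using (Bool; not; T)
open import Data.Sum using (_⊎_; inj₁; inj₂)
open import Data.Product using (Σ; _×_; _,_; proj₁; ∃-syntax)
open import Data.Unit using (⊤)
open import Data.Empty using (⊥)
open import Relation.Nullary using (¬_)
open import Relation.Binary.PropositionalEquality using (_≡_; _≢_)

Rel : Set → Set₁
Rel A = A → A → Set

Lt : {A : Set} → Rel A → Rel A
Lt R x y = R x y × x ≢ y

Cov : {A : Set} → Rel A → Rel A
Cov R x y = Lt R x y × (∀ z → Lt R x z → Lt R z y → ⊥)

-- reducible = not doubly irreducible: at least two lower covers
-- or at least two upper covers
Reducible : {A : Set} → Rel A → A → Set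
Reducible R x =
  (∃[ y ] ∃[ z ] (y ≢ z × Cov R y x × Cov R z x))
  ⊎ (∃[ y ] ∃[ z ] (y ≢ z × Cov R x y × Cov R x z))

IsMaximalChain : {A : Set} → Rel A → (A → Set) → Set
IsMaximalChain {A} R S =
  (∀ x y → S x → S y → R x y ⊎ R y x)
  × (∀ x → (∀ y → S y → R x y ⊎ R y x) → S x)

IsLinExt : {A : Set} → Rel A → Rel A → Set
IsLinExt {A} R L =
  (∀ x y → R x y → L x y)
  × (∀ x → L x x)
  × (∀ x y → L x y → L y x → x ≡ y)
  × (∀ x y z → L x y → L y z → L x z)
  × (∀ x y → L x y ⊎ L y x)

Realizer : {A : Set} → Rel A → ℕ → Set₁
Realizer {A} R d =
  Σ (Fin d → Rel A) λ Ls →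
    (∀ t → IsLinExt R (Ls t))
    × (∀ x y → (R x y → ∀ t → Ls t x y) × ((∀ t → Ls t x y) → R x y))

IsDim : {A : Set} → Rel A → ℕ → Set₁
IsDim R d = Realizer R d × (∀ e → Realizer R e → d Data.Nat.≤ e)

SubCar : (A : Set) → (A → Bool) → Set
SubCar A keep = Σ A (λ x → T (keep x))

SubRel : {A : Set} → Rel A → (keep : A → Bool) → Rel (SubCar A keep)
SubRel R keep x y = R (proj₁ x) (proj₁ y)

AdjRel : {A : Set} → Rel A → (a b : A) → (m : ℕ) → Rel (A ⊎ Fin (suc m))
AdjRel R a b m (inj₁ x) (inj₁ y) = R x y
AdjRel R a b m (inj₂ x) (inj₂ y) = x F.≤ y
AdjRel R a b m (inj₁ x) (inj₂ y) = R x a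
AdjRel R a b m (inj₂ x) (inj₁ y) = R b y

-- Presentations  C_0 ]^{b_1}_{a_1} C_1 ... ]^{b_k}_{a_k} C_k
-- (evaluated left to right) of iterated adjunct sums of finite
-- nonempty chains; C_j is the chain Fin (suc m_j).

mutual
  data Pres : ℕ → Set where
    base : (m₀ : ℕ) → Pres zero
    step : ∀ {k} (p : Pres k) (a b : Car p) (m : ℕ) → Pres (suc k)

  Car : ∀ {k} → Pres k → Set
  Car (base m₀) = Fin (suc m₀)
  Car (step p a b m) = Car p ⊎ Fin (suc m)

Le : ∀ {k} (p : Pres k) → Rel (Car p)
Le (base m₀) x y = x F.≤ y
Le (step p a b m) = AdjRel (Le p) a b m

Valid : ∀ {k} → Pres k → Set
Valid (base m₀) = ⊤
Valid (step p a b m) = Valid p × Lt (Le p) a b × ¬ Cov (Le p) a b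

comp : ∀ {k} (p : Pres k) → Car p → ℕ
comp (base m₀) x = zero
comp {suc k} (step p a b m) (inj₁ x) = comp p x
comp {suc k} (step p a b m) (inj₂ x) = suc k

InC : ∀ {k} (p : Pres k) → ℕ → Car p → Set
InC p j x = comp p x ≡ j

notInC : ∀ {k} (p : Pres k) → ℕ → Car p → Bool
notInC p i x = not (comp p x ≡ᵇ i)

MinusRel : ∀ {k} (p : Pres k) (i : ℕ) → Rel (SubCar (Car p) (notInC p i))
MinusRel p i = SubRel (Le p) (notInC p i)

{-# OPTIONS --safe #-}
module Submission where

-- C_i contains no reducible element of L. Attachment points of adjunct sums are reducible:
-- a has the two upper covers "least element of the new chain" and "some cover of a below b",
-- and dually for b. Hence no later chain is attached at a point of C_i, and by induction along the
-- presentation C_i sits in L exactly as in a single adjunct sum ]^b_a with a < b outside C_i: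
-- an element of C_i lies below y ∉ C_i iff b ≤ y, and above y iff y ≤ a.
--
-- From a realizer L_1, …, L_e of L ∖ C_i one obtains a realizer of L with e + 1 extensions:
-- insert C_i into every L_t directly above a, and add one extension obtained from L_1 by
-- moving the up-set of b to the top and inserting C_i just below it. The first e extensions
-- put C_i below every y with y ≰ a, the last one puts C_i above every y with b ≰ y.

open import Defs
open import Data.Nat as ℕ using (ℕ; zero; suc; _≤_; _<_; z≤n; s≤s)
import Data.Nat.Properties as ℕ
open import Data.Fin as Fin using (Fin; zero; suc; fromℕ)
import Data.Fin.Properties as Fin
open import Data.Bool using (Bool; not; T; if_then_else_)
open import Data.Bool.Properties using (T-irrelevant)
open import Data.Sum as Sum using (_⊎_; inj₁; inj₂; [_,_])
import Data.Sum.Properties as Sum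
open import Data.Sum.Relation.Binary.Pointwise
  using (Pointwise; inj₁; inj₂; ⊎-refl; ⊎-transitive; ⊎-antisymmetric; Pointwise-≡⇒≡)
open import Data.Product as Product using (_×_; _,_; proj₁; proj₂; ∃-syntax)
open import Data.Unit using (tt)
open import Data.Empty using (⊥)
open import Data.List using (List; []; _∷_; _++_; map; allFin)
open import Data.List.Membership.Propositional using (_∈_)
open import Data.List.Membership.Propositional.Properties using (∈-allFin; ∈-++⁺ˡ; ∈-++⁺ʳ; ∈-map⁺)
open import Data.List.Relation.Unary.Any using (here; there)
open import Function using (_∘_; id; flip; _on_)
open import Function.Bundles using (_⇔_; mk⇔; Equivalence)
open import Function.Definitions using (Injective)
open import Relation.Nullary using (¬_; Dec; yes; no; does; contradiction; ¬?)
open import Relation.Nullary.Decidable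
  using (isYes; toWitness; fromWitness; map′; _×-dec_; decidable-stable; ¬¬-excluded-middle)
open import Relation.Binary.Definitions
  using (Reflexive; Transitive; Antisymmetric; Total; Decidable; DecidableEquality)
  using (tri<; tri≈; tri>)
open import Relation.Binary.Structures using (IsPartialOrder; IsTotalOrder)
open import Relation.Binary.Consequences using (total∧dec⇒dec)
open import Relation.Binary.PropositionalEquality
  using (_≡_; _≢_; refl; sym; trans; cong; subst₂; isEquivalence; module ≡-Reasoning)
import Relation.Binary.Construct.NonStrictToStrict as Strict
import Relation.Binary.Construct.Flip.EqAndOrd as Flip

mkIsPartialOrder : {A : Set} {R : Rel A} → (∀ x → R x x) → (∀ x y z → R x y → R y z → R x z)
  → (∀ x y → R x y → R y x → x ≡ y) → IsPartialOrder _≡_ R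
mkIsPartialOrder R-refl R-trans R-antisym = record
  { isPreorder = record
    { isEquivalence = isEquivalence
    ; reflexive = λ { {x} refl → R-refl x }
    ; trans = R-trans _ _ _
    }
  ; antisym = R-antisym _ _
  }

isLinExt⇒isTotalOrder : {A : Set} {R L : Rel A} → IsLinExt R L → IsTotalOrder _≡_ L
isLinExt⇒isTotalOrder (_ , L-refl , L-antisym , L-trans , L-total) = record
  { isPartialOrder = mkIsPartialOrder L-refl L-trans L-antisym
  ; total = L-total
  }

isLinExt-on : {A B : Set} {R : Rel A} {S : Rel B} (f : A → B) → Injective _≡_ _≡_ f
  → IsTotalOrder _≡_ S → (∀ {x y} → R x y → S (f x) (f y)) → IsLinExt R (S on f)
isLinExt-on f f-injective S-totalOrder R⇒S =
  (λ _ _ → R⇒S) , (λ _ → S.refl) , (λ _ _ x≤y y≤x → f-injective (S.antisym x≤y y≤x))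
  , (λ _ _ _ → S.trans) , (λ x y → S.total (f x) (f y))
  where module S = IsTotalOrder S-totalOrder

realizer₀-complete : {A : Set} {R : Rel A} → Realizer R 0 → ∀ x y → R x y
realizer₀-complete (_ , _ , realizes) x y = proj₂ (realizes x y) λ ()

T-not-does⇒¬ : {X : Set} (x? : Dec X) → T (not (does x?)) → ¬ X
T-not-does⇒¬ (no ¬x) _ = ¬x

¬⇒T-not-does : {X : Set} (x? : Dec X) → ¬ X → T (not (does x?))
¬⇒T-not-does (yes x) ¬x = ¬x x
¬⇒T-not-does (no _) _ = tt

SubCar-≡ : {A : Set} {keep : A → Bool} {x y : SubCar A keep} → proj₁ x ≡ proj₁ y → x ≡ y
SubCar-≡ {x = x , x-kept} {.x , x-kept′} refl = cong (x ,_) (T-irrelevant x-kept x-kept′)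

SubCar-≟ : {A : Set} {keep : A → Bool} → DecidableEquality A → DecidableEquality (SubCar A keep)
SubCar-≟ _≟_ x y = map′ SubCar-≡ (cong proj₁) (proj₁ x ≟ proj₁ y)

Layered : {B : Set} → (B → ℕ) → Rel B → Rel B
Layered level K x y = level x < level y ⊎ (level x ≡ level y × K x y)

layered-isTotalOrder : {B : Set} {level : B → ℕ} {K : Rel B}
  → Reflexive K → Antisymmetric _≡_ K → Transitive K
  → (∀ {x y} → level x ≡ level y → K x y ⊎ K y x) → IsTotalOrder _≡_ (Layered level K)
layered-isTotalOrder {level = level} {K} K-refl K-antisym K-trans K-total = record
  { isPartialOrder =
      mkIsPartialOrder (λ _ → inj₂ (refl , K-refl)) (λ _ _ _ → trans′) (λ _ _ → antisym′)
  ; total = total′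
  }
  where
  trans′ : Transitive (Layered level K)
  trans′ (inj₁ x<y) (inj₁ y<z) = inj₁ (ℕ.<-trans x<y y<z)
  trans′ (inj₁ x<y) (inj₂ (y≡z , _)) = inj₁ (ℕ.<-≤-trans x<y (ℕ.≤-reflexive y≡z))
  trans′ (inj₂ (x≡y , _)) (inj₁ y<z) = inj₁ (ℕ.≤-<-trans (ℕ.≤-reflexive x≡y) y<z)
  trans′ (inj₂ (x≡y , x≤y)) (inj₂ (y≡z , y≤z)) = inj₂ (trans x≡y y≡z , K-trans x≤y y≤z)

  antisym′ : Antisymmetric _≡_ (Layered level K)
  antisym′ (inj₁ x<y) (inj₁ y<x) = contradiction y<x (ℕ.<-asym x<y)
  antisym′ (inj₁ x<y) (inj₂ (y≡x , _)) = contradiction x<y (ℕ.<-irrefl (sym y≡x))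
  antisym′ (inj₂ (x≡y , _)) (inj₁ y<x) = contradiction y<x (ℕ.<-irrefl (sym x≡y))
  antisym′ (inj₂ (_ , x≤y)) (inj₂ (_ , y≤x)) = K-antisym x≤y y≤x

  total′ : Total (Layered level K)
  total′ x y with ℕ.<-cmp (level x) (level y)
  ... | tri< x<y _ _ = inj₁ (inj₁ x<y)
  ... | tri≈ _ x≡y _ = Sum.map (inj₂ ∘ (x≡y ,_)) (inj₂ ∘ (sym x≡y ,_)) (K-total x≡y)
  ... | tri> _ _ y<x = inj₂ (inj₁ y<x)

module ChainInsertion {A : Set} {R : Rel A} (R-po : IsPartialOrder _≡_ R)
  {C : A → Set} (C? : ∀ x → Dec (C x)) (C-chain : ∀ {x y} → C x → C y → R x y ⊎ R y x) where

  -- For C = InC p i this is definitionally the carrier of MinusRel p i, since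
  -- does (n ≟ i) computes to n ≡ᵇ i.
  Rest : Set
  Rest = SubCar A (λ x → not (does (C? x)))

  Chain : Set
  Chain = SubCar A (λ x → isYes (C? x))

  RRest : Rel Rest
  RRest = SubRel R (λ x → not (does (C? x)))

  RChain : Rel Chain
  RChain = SubRel R (λ x → isYes (C? x))

  rest-∉ : (y : Rest) → ¬ C (proj₁ y)
  rest-∉ (y , y-kept) = T-not-does⇒¬ (C? y) y-kept

  chain-∈ : (x : Chain) → C (proj₁ x)
  chain-∈ (x , x∈C) = toWitness x∈C

  split : A → Rest ⊎ Chain
  split x with C? x
  ... | yes x∈C = inj₂ (x , fromWitness x∈C)
  ... | no x∉C = inj₁ (x , ¬⇒T-not-does (C? x) x∉C)

  merge : Rest ⊎ Chain → A
  merge = [ proj₁ , proj₁ ]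

  merge-split : ∀ x → merge (split x) ≡ x
  merge-split x with C? x
  ... | yes _ = refl
  ... | no _ = refl

  split-injective : Injective _≡_ _≡_ split
  split-injective {x} {y} split-x≡split-y = begin
    x                ≡⟨ merge-split x ⟨
    merge (split x)  ≡⟨ cong merge split-x≡split-y ⟩
    merge (split y)  ≡⟨ merge-split y ⟩
    y                ∎
    where open ≡-Reasoning

  private
    module R = IsPartialOrder R-po

  module Insert {L : Rel Rest} (L-lin : IsLinExt RRest L)
    {U : Rest → Set} (U? : ∀ y → Dec (U y)) where

    private
      module L = IsTotalOrder (isLinExt⇒isTotalOrder L-lin)

    level : Rest ⊎ Chain → ℕ
    level (inj₁ y) = if does (U? y) then 2 else 0
    level (inj₂ _) = 1

    infix 4 _⊑_
    _⊑_ : Rel (Rest ⊎ Chain)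
    _⊑_ = Layered level (Pointwise L RChain)

    Inserted : Rel A
    Inserted = _⊑_ on split

    level-rest≢level-chain : ∀ y x → level (inj₁ y) ≢ level (inj₂ x)
    level-rest≢level-chain y _ with U? y
    ... | yes _ = λ ()
    ... | no _ = λ ()

    ⊑-isTotalOrder : IsTotalOrder _≡_ _⊑_
    ⊑-isTotalOrder = layered-isTotalOrder (⊎-refl {S = RChain} L.refl R.refl)
      (λ q≤q′ q′≤q → Pointwise-≡⇒≡ (⊎-antisymmetric L.antisym RChain-antisym q≤q′ q′≤q))
      (⊎-transitive {S = RChain} L.trans R.trans) same-level-total
      where
      RChain-antisym : ∀ {x x′} → RChain x x′ → RChain x′ x → x ≡ x′
      RChain-antisym x≤x′ x′≤x = SubCar-≡ (R.antisym x≤x′ x′≤x)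

      same-level-total : ∀ {q q′} → level q ≡ level q′
        → Pointwise L RChain q q′ ⊎ Pointwise L RChain q′ q
      same-level-total {inj₁ y} {inj₁ z} _ = Sum.map inj₁ inj₁ (L.total y z)
      same-level-total {inj₂ x} {inj₂ x′} _ =
        Sum.map inj₂ inj₂ (C-chain (chain-∈ x) (chain-∈ x′))
      same-level-total {inj₁ y} {inj₂ x} eq = contradiction eq (level-rest≢level-chain y x)
      same-level-total {inj₂ x} {inj₁ y} eq = contradiction (sym eq) (level-rest≢level-chain y x)

    Inserted-isLinExt : (∀ {y z} → RRest y z → U y → U z)
      → (∀ (x : Chain) y → R (proj₁ x) (proj₁ y) → U y)
      → (∀ (x : Chain) y → R (proj₁ y) (proj₁ x) → ¬ U y)
      → IsLinExt R Inserted
    Inserted-isLinExt U-upward chain≤⇒U ≤chain⇒¬U =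
      isLinExt-on split split-injective ⊑-isTotalOrder extends
      where
      merge-extends : ∀ q q′ → R (merge q) (merge q′) → q ⊑ q′
      merge-extends (inj₁ y) (inj₁ z) y≤z with U? y | U? z
      ... | yes _ | yes _ = inj₂ (refl , inj₁ (proj₁ L-lin y z y≤z))
      ... | no _ | no _ = inj₂ (refl , inj₁ (proj₁ L-lin y z y≤z))
      ... | no _ | yes _ = inj₁ (s≤s z≤n)
      ... | yes Uy | no ¬Uz = contradiction (U-upward y≤z Uy) ¬Uz
      merge-extends (inj₁ y) (inj₂ x) y≤x with U? y
      ... | yes Uy = contradiction Uy (≤chain⇒¬U x y y≤x)
      ... | no _ = inj₁ (s≤s z≤n)
      merge-extends (inj₂ x) (inj₁ y) x≤y with U? y
      ... | yes _ = inj₁ (s≤s (s≤s z≤n))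
      ... | no ¬Uy = contradiction (chain≤⇒U x y x≤y) ¬Uy
      merge-extends (inj₂ x) (inj₂ x′) x≤x′ = inj₂ (refl , inj₂ x≤x′)

      extends : ∀ {x y} → R x y → split x ⊑ split y
      extends {x} {y} x≤y = merge-extends (split x) (split y)
        (subst₂ R (sym (merge-split x)) (sym (merge-split y)) x≤y)

    rest⊑rest⇒L : (∀ {y z} → L y z → U y → U z) → ∀ {y z} → inj₁ y ⊑ inj₁ z → L y z
    rest⊑rest⇒L _ (inj₂ (_ , inj₁ y≤z)) = y≤z
    rest⊑rest⇒L U-upward {y} {z} (inj₁ _) with U? y | U? z
    ... | no ¬Uy | yes Uz = Sum.[ id , (λ z≤y → contradiction (U-upward z≤y Uz) ¬Uy) ] (L.total y z)
    rest⊑rest⇒L _ (inj₁ (s≤s (s≤s ()))) | yes _ | yes _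
    rest⊑rest⇒L _ (inj₁ ()) | yes _ | no _
    rest⊑rest⇒L _ (inj₁ ()) | no _ | no _

    rest⊑chain⇒¬U : ∀ {y x} → inj₁ y ⊑ inj₂ x → ¬ U y
    rest⊑chain⇒¬U {y} y⊑x with U? y
    ... | no ¬Uy = ¬Uy
    rest⊑chain⇒¬U (inj₁ (s≤s ())) | yes _
    rest⊑chain⇒¬U (inj₂ (() , _)) | yes _

    chain⊑rest⇒U : ∀ {x y} → inj₂ x ⊑ inj₁ y → U y
    chain⊑rest⇒U {y = y} x⊑y with U? y
    ... | yes Uy = Uy
    chain⊑rest⇒U (inj₁ ()) | no _
    chain⊑rest⇒U (inj₂ (() , _)) | no _

    chain⊑chain⇒R : ∀ {x x′} → inj₂ x ⊑ inj₂ x′ → RChain x x′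
    chain⊑chain⇒R (inj₁ (s≤s ()))
    chain⊑chain⇒R (inj₂ (_ , inj₂ x≤x′)) = x≤x′

-- C sits in R as the chain of an adjunct sum ]^b_a sits in it.
record Attachment {A : Set} (R : Rel A) (C : A → Set) : Set where
  field
    a b : A
    a∉C : ¬ C a
    b∉C : ¬ C b
    a<b : Lt R a b
    above : ∀ x y → C x → ¬ C y → R x y ⇔ R b y
    below : ∀ x y → C x → ¬ C y → R y x ⇔ R y a

module _ {A : Set} {R : Rel A} (R-po : IsPartialOrder _≡_ R) (R? : Decidable R)
  (_≟_ : DecidableEquality A) {C : A → Set} (C? : ∀ x → Dec (C x))
  (C-chain : ∀ {x y} → C x → C y → R x y ⊎ R y x) (attachment : Attachment R C) where

  private
    module R = IsPartialOrder R-po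
  open ChainInsertion R-po C? C-chain
  open Attachment attachment

  private
    b≰a : ¬ R b a
    b≰a = Strict.<⇒≱ _≡_ R R.antisym a<b

    aᴿ bᴿ : Rest
    aᴿ = a , ¬⇒T-not-does (C? a) a∉C
    bᴿ = b , ¬⇒T-not-does (C? b) b∉C

    chain≤⇒b≤ : ∀ (x : Chain) (y : Rest) → R (proj₁ x) (proj₁ y) → R b (proj₁ y)
    chain≤⇒b≤ x y = Equivalence.to (above (proj₁ x) (proj₁ y) (chain-∈ x) (rest-∉ y))

    b≤⇒chain≤ : ∀ (x : Chain) (y : Rest) → R b (proj₁ y) → R (proj₁ x) (proj₁ y)
    b≤⇒chain≤ x y = Equivalence.from (above (proj₁ x) (proj₁ y) (chain-∈ x) (rest-∉ y))

    ≤chain⇒≤a : ∀ (x : Chain) (y : Rest) → R (proj₁ y) (proj₁ x) → R (proj₁ y) a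
    ≤chain⇒≤a x y = Equivalence.to (below (proj₁ x) (proj₁ y) (chain-∈ x) (rest-∉ y))

    ≤a⇒≤chain : ∀ (x : Chain) (y : Rest) → R (proj₁ y) a → R (proj₁ y) (proj₁ x)
    ≤a⇒≤chain x y = Equivalence.from (below (proj₁ x) (proj₁ y) (chain-∈ x) (rest-∉ y))

    module JustAboveA {L : Rel Rest} (L-lin : IsLinExt RRest L) where
      private
        module L = IsTotalOrder (isLinExt⇒isTotalOrder L-lin)

      L? : Decidable L
      L? = total∧dec⇒dec (λ { refl → L.refl }) L.antisym L.total (SubCar-≟ _≟_)

      private
        module I = ChainInsertion.Insert R-po C? C-chain L-lin (λ y → ¬? (L? y aᴿ))
      open I public hiding (rest⊑rest⇒L)

      L-upward : ∀ {y z} → L y z → ¬ L y aᴿ → ¬ L z aᴿ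
      L-upward y≤z y≰a z≤a = y≰a (L.trans y≤z z≤a)

      isLinExt : IsLinExt R Inserted
      isLinExt = Inserted-isLinExt (λ {y} {z} y≤z → L-upward (proj₁ L-lin y z y≤z))
        chain≤⇒≰a ≤chain⇒≮≮a
        where
        chain≤⇒≰a : ∀ (x : Chain) y → R (proj₁ x) (proj₁ y) → ¬ L y aᴿ
        chain≤⇒≰a x y x≤y y≤a = proj₂ a<b (cong proj₁ (L.antisym a≤b b≤a))
          where
          a≤b = proj₁ L-lin aᴿ bᴿ (proj₁ a<b)
          b≤a = L.trans (proj₁ L-lin bᴿ y (chain≤⇒b≤ x y x≤y)) y≤a

        ≤chain⇒≮≮a : ∀ (x : Chain) y → R (proj₁ y) (proj₁ x) → ¬ ¬ L y aᴿ
        ≤chain⇒≮≮a x y y≤x y≰a = y≰a (proj₁ L-lin y aᴿ (≤chain⇒≤a x y y≤x))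

      rest⊑chain⇒≤a : ∀ {y x} → inj₁ y ⊑ inj₂ x → L y aᴿ
      rest⊑chain⇒≤a = decidable-stable (L? _ aᴿ) ∘ rest⊑chain⇒¬U

      rest⊑rest⇒L : ∀ {y z} → inj₁ y ⊑ inj₁ z → L y z
      rest⊑rest⇒L = I.rest⊑rest⇒L L-upward

    module JustBelow↑b {L : Rel Rest} (L-lin : IsLinExt RRest L) where
      open ChainInsertion.Insert R-po C? C-chain L-lin (λ y → R? b (proj₁ y)) public

      isLinExt : IsLinExt R Inserted
      isLinExt = Inserted-isLinExt (λ y≤z b≤y → R.trans b≤y y≤z) chain≤⇒b≤
        (λ x y y≤x b≤y → b≰a (R.trans b≤y (≤chain⇒≤a x y y≤x)))

  attached-realizer : ∀ {e} → Realizer RRest e → Realizer R (suc e)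
  attached-realizer {zero} ρ = contradiction (realizer₀-complete ρ bᴿ aᴿ) b≰a
  attached-realizer {suc e} (Ls , Ls-lin , Ls-realizes) =
    Ls′ , Ls′-lin , λ x y → (λ x≤y t → proj₁ (Ls′-lin t) x y x≤y) , reflects x y
    where
    module Above t = JustAboveA (Ls-lin t)
    module Below = JustBelow↑b (Ls-lin zero)

    Ls′ : Fin (suc (suc e)) → Rel A
    Ls′ zero = Below.Inserted
    Ls′ (suc t) = Above.Inserted t

    Ls′-lin : ∀ t → IsLinExt R (Ls′ t)
    Ls′-lin zero = Below.isLinExt
    Ls′-lin (suc t) = Above.isLinExt t

    merge-reflects : ∀ q q′ → q Below.⊑ q′ → (∀ t → Above._⊑_ t q q′) → R (merge q) (merge q′)
    merge-reflects (inj₁ y) (inj₁ z) _ y⊑z =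
      proj₂ (Ls-realizes y z) (λ t → Above.rest⊑rest⇒L t (y⊑z t))
    merge-reflects (inj₁ y) (inj₂ x) _ y⊑x =
      ≤a⇒≤chain x y (proj₂ (Ls-realizes y aᴿ) (λ t → Above.rest⊑chain⇒≤a t (y⊑x t)))
    merge-reflects (inj₂ x) (inj₁ y) x⊑y _ = b≤⇒chain≤ x y (Below.chain⊑rest⇒U x⊑y)
    merge-reflects (inj₂ x) (inj₂ x′) x⊑x′ _ = Below.chain⊑chain⇒R x⊑x′

    reflects : ∀ x y → (∀ t → Ls′ t x y) → R x y
    reflects x y x≤y = subst₂ R (merge-split x) (merge-split y)
      (merge-reflects (split x) (split y) (x≤y zero) (x≤y ∘ suc))

Cov-flip : {A : Set} {R : Rel A} {v w : A} → Cov (flip R) v w → Cov R w v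
Cov-flip ((w≤v , v≢w) , v⋖w) =
  (w≤v , v≢w ∘ sym) , λ z (w≤z , w≢z) (z≤v , z≢v) → v⋖w z (z≤v , z≢v ∘ sym) (w≤z , w≢z ∘ sym)

module FiniteCovers {A : Set} (_≟_ : DecidableEquality A)
  {elements : List A} (complete : ∀ x → x ∈ elements) where

  upper-cover : {R : Rel A} → IsPartialOrder _≡_ R → Decidable R
    → ∀ {u v} → Lt R u v → ∃[ w ] Cov R u w
  upper-cover {R} R-po R? u<v =
    Product.map₂ proj₁ (cover-below elements (λ {w} _ _ → complete w) u<v)
    where
    module R = IsPartialOrder R-po
    open Strict _≡_ R using (<-trans; <-decidable)

    _<?_ : Decidable (Lt R)
    _<?_ = <-decidable _≟_ R?

    drop : ∀ {z w ws} → z ∈ w ∷ ws → z ≢ w → z ∈ ws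
    drop (here z≡w) z≢w = contradiction z≡w z≢w
    drop (there z∈ws) _ = z∈ws

    cover-below : ∀ {u v} xs → (∀ {w} → Lt R u w → Lt R w v → w ∈ xs)
      → Lt R u v → ∃[ w ] Cov R u w × R w v
    cover-below {v = v} [] between u<v =
      v , (u<v , λ _ u<z z<v → contradiction (between u<z z<v) λ ()) , R.refl
    cover-below {u} {v} (w ∷ ws) between u<v with u <? w ×-dec w <? v
    ... | yes (u<w , w<v) = Product.map₂ (Product.map₂ (λ w′≤w → R.trans w′≤w (proj₁ w<v)))
      (cover-below ws (λ u<z z<w → drop (between u<z (<-trans R-po z<w w<v)) (proj₂ z<w)) u<w)
    ... | no ¬u<w<v =
      cover-below ws (λ u<z z<v → drop (between u<z z<v) λ { refl → ¬u<w<v (u<z , z<v) }) u<v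

  lower-cover : {R : Rel A} → IsPartialOrder _≡_ R → Decidable R
    → ∀ {u v} → Lt R u v → ∃[ w ] Cov R w v
  lower-cover R-po R? (u≤v , u≢v) =
    Product.map₂ Cov-flip (upper-cover (Flip.isPartialOrder R-po) (flip R?) (u≤v , u≢v ∘ sym))

AdjRel-decidable : {A : Set} {R : Rel A} {a b : A} {m : ℕ}
  → Decidable R → Decidable (AdjRel R a b m)
AdjRel-decidable R? (inj₁ x) (inj₁ y) = R? x y
AdjRel-decidable {a = a} R? (inj₁ x) (inj₂ _) = R? x a
AdjRel-decidable {b = b} R? (inj₂ _) (inj₁ y) = R? b y
AdjRel-decidable R? (inj₂ x) (inj₂ y) = x Fin.≤? y

module AdjunctSum {A : Set} {R : Rel A} (R-po : IsPartialOrder _≡_ R)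
  {a b : A} (a<b : Lt R a b) (m : ℕ) where

  private
    module R = IsPartialOrder R-po

    S : Rel (A ⊎ Fin (suc m))
    S = AdjRel R a b m

    b≰a : ¬ R b a
    b≰a = Strict.<⇒≱ _≡_ R R.antisym a<b

  isPartialOrder : IsPartialOrder _≡_ S
  isPartialOrder = mkIsPartialOrder S-refl S-trans S-antisym
    where
    S-refl : ∀ x → S x x
    S-refl (inj₁ _) = R.refl
    S-refl (inj₂ _) = Fin.≤-refl

    S-trans : ∀ x y z → S x y → S y z → S x z
    S-trans (inj₁ _) (inj₁ _) (inj₁ _) x≤y y≤z = R.trans x≤y y≤z
    S-trans (inj₁ _) (inj₁ _) (inj₂ _) x≤y y≤a = R.trans x≤y y≤a
    S-trans (inj₁ _) (inj₂ _) (inj₁ _) x≤a b≤z = R.trans (R.trans x≤a (proj₁ a<b)) b≤z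
    S-trans (inj₁ _) (inj₂ _) (inj₂ _) x≤a _ = x≤a
    S-trans (inj₂ _) (inj₁ _) (inj₁ _) b≤y y≤z = R.trans b≤y y≤z
    S-trans (inj₂ _) (inj₁ _) (inj₂ _) b≤y y≤a = contradiction (R.trans b≤y y≤a) b≰a
    S-trans (inj₂ _) (inj₂ _) (inj₁ _) _ b≤z = b≤z
    S-trans (inj₂ _) (inj₂ _) (inj₂ _) x≤y y≤z = Fin.≤-trans x≤y y≤z

    S-antisym : ∀ x y → S x y → S y x → x ≡ y
    S-antisym (inj₁ _) (inj₁ _) x≤y y≤x = cong inj₁ (R.antisym x≤y y≤x)
    S-antisym (inj₁ _) (inj₂ _) x≤a b≤x = contradiction (R.trans b≤x x≤a) b≰a
    S-antisym (inj₂ _) (inj₁ _) b≤y y≤a = contradiction (R.trans b≤y y≤a) b≰a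
    S-antisym (inj₂ _) (inj₂ _) x≤y y≤x = cong inj₂ (Fin.≤-antisym x≤y y≤x)

  lift-Lt : ∀ {u v} → Lt R u v → Lt S (inj₁ u) (inj₁ v)
  lift-Lt (u≤v , u≢v) = u≤v , u≢v ∘ Sum.inj₁-injective

  -- A chain element between u and v forces u ≤ a < b ≤ v; then a or b lies strictly between
  -- u and v unless u = a and v = b, which a ⊀ b excludes. Since the goal is ⊥, the case
  -- distinctions need no decidable equality.
  lift-Cov : ¬ Cov R a b → ∀ {u v} → Cov R u v → Cov S (inj₁ u) (inj₁ v)
  lift-Cov a⊀b {u} {v} (u<v , u⋖v) = lift-Lt u<v , nothing-between
    where
    through-a-and-b : R u a → R b v → ⊥
    through-a-and-b u≤a b≤v = ¬¬-excluded-middle λ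
      { (no u≢a) → u⋖v a (u≤a , u≢a) (R.trans (proj₁ a<b) b≤v , λ { refl → b≰a b≤v })
      ; (yes refl) → ¬¬-excluded-middle λ
        { (no b≢v) → u⋖v b a<b (b≤v , b≢v)
        ; (yes refl) → a⊀b (u<v , u⋖v)
        }
      }

    nothing-between : ∀ z → Lt S (inj₁ u) z → Lt S z (inj₁ v) → ⊥
    nothing-between (inj₁ w) (u≤w , u≢w) (w≤v , w≢v) =
      u⋖v w (u≤w , u≢w ∘ cong inj₁) (w≤v , w≢v ∘ cong inj₁)
    nothing-between (inj₂ _) (u≤a , _) (b≤v , _) = through-a-and-b u≤a b≤v

  lift-Reducible : ¬ Cov R a b → ∀ {x} → Reducible R x → Reducible S (inj₁ x)
  lift-Reducible a⊀b (inj₁ (y , z , y≢z , y⋖x , z⋖x)) =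
    inj₁ (inj₁ y , inj₁ z , y≢z ∘ Sum.inj₁-injective , lift-Cov a⊀b y⋖x , lift-Cov a⊀b z⋖x)
  lift-Reducible a⊀b (inj₂ (y , z , y≢z , x⋖y , x⋖z)) =
    inj₂ (inj₁ y , inj₁ z , y≢z ∘ Sum.inj₁-injective , lift-Cov a⊀b x⋖y , lift-Cov a⊀b x⋖z)

  a⋖chain : Cov S (inj₁ a) (inj₂ zero)
  a⋖chain = (R.refl , λ ()) , nothing-between
    where
    nothing-between : ∀ z → Lt S (inj₁ a) z → Lt S z (inj₂ zero) → ⊥
    nothing-between (inj₁ w) (a≤w , a≢w) (w≤a , _) = a≢w (cong inj₁ (R.antisym a≤w w≤a))
    nothing-between (inj₂ c) _ (c≤0 , c≢0) = c≢0 (cong inj₂ (Fin.≤-antisym c≤0 z≤n))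

  chain⋖b : Cov S (inj₂ (fromℕ m)) (inj₁ b)
  chain⋖b = (R.refl , λ ()) , nothing-between
    where
    nothing-between : ∀ z → Lt S (inj₂ (fromℕ m)) z → Lt S z (inj₁ b) → ⊥
    nothing-between (inj₁ w) (b≤w , _) (w≤b , w≢b) = w≢b (cong inj₁ (R.antisym w≤b b≤w))
    nothing-between (inj₂ c) (top≤c , top≢c) _ =
      top≢c (cong inj₂ (Fin.≤-antisym top≤c (Fin.≤fromℕ c)))

  a-reducible : ¬ Cov R a b → ∀ {w} → Cov R a w → Reducible S (inj₁ a)
  a-reducible a⊀b a⋖w = inj₂ (inj₂ zero , inj₁ _ , (λ ()) , a⋖chain , lift-Cov a⊀b a⋖w)

  b-reducible : ¬ Cov R a b → ∀ {w} → Cov R w b → Reducible S (inj₁ b)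
  b-reducible a⊀b w⋖b = inj₁ (inj₂ (fromℕ m) , inj₁ _ , (λ ()) , chain⋖b , lift-Cov a⊀b w⋖b)

Le-isPartialOrder : ∀ {k} (p : Pres k) → Valid p → IsPartialOrder _≡_ (Le p)
Le-isPartialOrder (base _) _ = Fin.≤-isPartialOrder
Le-isPartialOrder (step p _ _ m) (valid , a<b , _) =
  AdjunctSum.isPartialOrder (Le-isPartialOrder p valid) a<b m

Le? : ∀ {k} (p : Pres k) → Decidable (Le p)
Le? (base _) = Fin._≤?_
Le? (step p _ _ _) = AdjRel-decidable (Le? p)

Car-≟ : ∀ {k} (p : Pres k) → DecidableEquality (Car p)
Car-≟ (base _) = Fin._≟_
Car-≟ (step p _ _ _) = Sum.≡-dec (Car-≟ p) Fin._≟_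

elements : ∀ {k} (p : Pres k) → List (Car p)
elements (base m) = allFin (suc m)
elements (step p _ _ m) = map inj₁ (elements p) ++ map inj₂ (allFin (suc m))

elements-complete : ∀ {k} (p : Pres k) x → x ∈ elements p
elements-complete (base _) x = ∈-allFin x
elements-complete (step p _ _ _) (inj₁ x) = ∈-++⁺ˡ (∈-map⁺ inj₁ (elements-complete p x))
elements-complete (step p _ _ _) (inj₂ x) =
  ∈-++⁺ʳ (map inj₁ (elements p)) (∈-map⁺ inj₂ (∈-allFin x))

comp≤ : ∀ {k} (p : Pres k) x → comp p x ≤ k
comp≤ (base _) _ = z≤n
comp≤ (step p _ _ _) (inj₁ x) = ℕ.m≤n⇒m≤1+n (comp≤ p x)
comp≤ (step _ _ _ _) (inj₂ _) = ℕ.≤-refl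

comp≢suc : ∀ {k} (p : Pres k) x → comp p x ≢ suc k
comp≢suc p x = ℕ.<⇒≢ (s≤s (comp≤ p x))

InC-total : ∀ {k} (p : Pres k) {i x y} → InC p i x → InC p i y → Le p x y ⊎ Le p y x
InC-total (base _) {x = x} {y} _ _ = Fin.≤-total x y
InC-total (step p _ _ _) {x = inj₁ _} {inj₁ _} x∈C y∈C = InC-total p x∈C y∈C
InC-total (step p _ _ _) {x = inj₁ x} {inj₂ _} x∈C y∈C =
  contradiction (trans x∈C (sym y∈C)) (comp≢suc p x)
InC-total (step p _ _ _) {x = inj₂ _} {inj₁ y} x∈C y∈C =
  contradiction (trans y∈C (sym x∈C)) (comp≢suc p y)
InC-total (step _ _ _ _) {x = inj₂ x} {inj₂ y} _ _ = Fin.≤-total x y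

newest-chain-attached : ∀ {k} (p : Pres k) a b m → Lt (Le p) a b
  → Attachment (Le (step p a b m)) (InC (step p a b m) (suc k))
newest-chain-attached {k} p a b m (a≤b , a≢b) = record
  { a = inj₁ a ; b = inj₁ b ; a∉C = comp≢suc p a ; b∉C = comp≢suc p b
  ; a<b = a≤b , a≢b ∘ Sum.inj₁-injective
  ; above = above ; below = below
  }
  where
  C = InC (step p a b m) (suc k)
  S = Le (step p a b m)

  above : ∀ x y → C x → ¬ C y → S x y ⇔ S (inj₁ b) y
  above (inj₁ x) _ x∈C _ = contradiction x∈C (comp≢suc p x)
  above (inj₂ _) (inj₁ _) _ _ = mk⇔ id id
  above (inj₂ _) (inj₂ _) _ y∉C = contradiction refl y∉C

  below : ∀ x y → C x → ¬ C y → S y x ⇔ S y (inj₁ a)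
  below (inj₁ x) _ x∈C _ = contradiction x∈C (comp≢suc p x)
  below (inj₂ _) (inj₁ _) _ _ = mk⇔ id id
  below (inj₂ _) (inj₂ _) _ y∉C = contradiction refl y∉C

attachment-step : ∀ {k i} {p : Pres k} {a b m} → i ≢ suc k → ¬ InC p i a → ¬ InC p i b
  → Attachment (Le p) (InC p i) → Attachment (Le (step p a b m)) (InC (step p a b m) i)
attachment-step {i = i} {p} {a} {b} {m} i≢new a∉C b∉C att = record
  { a = inj₁ At.a ; b = inj₁ At.b ; a∉C = At.a∉C ; b∉C = At.b∉C
  ; a<b = proj₁ At.a<b , proj₂ At.a<b ∘ Sum.inj₁-injective
  ; above = above ; below = below
  }
  where
  module At = Attachment att
  C = InC (step p a b m) i
  S = Le (step p a b m)

  above : ∀ x y → C x → ¬ C y → S x y ⇔ S (inj₁ At.b) y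
  above (inj₂ _) _ x∈C _ = contradiction (sym x∈C) i≢new
  above (inj₁ x) (inj₁ y) x∈C y∉C = At.above x y x∈C y∉C
  above (inj₁ x) (inj₂ _) x∈C _ = At.above x a x∈C a∉C

  below : ∀ x y → C x → ¬ C y → S y x ⇔ S y (inj₁ At.a)
  below (inj₂ _) _ x∈C _ = contradiction (sym x∈C) i≢new
  below (inj₁ x) (inj₁ y) x∈C y∉C = At.below x y x∈C y∉C
  below (inj₁ x) (inj₂ _) x∈C _ = At.below x b x∈C b∉C

chain-attached : ∀ {k} (p : Pres k) → Valid p → ∀ {i} → 1 ≤ i → i ≤ k
  → (∀ {x} → InC p i x → ¬ Reducible (Le p) x) → Attachment (Le p) (InC p i)
chain-attached (base _) _ (s≤s _) ()
chain-attached {suc k} (step p a b m) (valid , a<b , a⊀b) {i} 1≤i i≤1+k irreducible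
  with i ℕ.≟ suc k
... | yes refl = newest-chain-attached p a b m a<b
... | no i≢1+k = attachment-step i≢1+k a∉C b∉C (chain-attached p valid 1≤i i≤k irreducible-in-p)
  where
  open AdjunctSum (Le-isPartialOrder p valid) a<b m
  open FiniteCovers (Car-≟ p) (elements-complete p)

  i≤k : i ≤ k
  i≤k = ℕ.≤-pred (ℕ.≤∧≢⇒< i≤1+k i≢1+k)

  irreducible-in-p : ∀ {x} → InC p i x → ¬ Reducible (Le p) x
  irreducible-in-p x∈C = irreducible x∈C ∘ lift-Reducible a⊀b

  a∉C : ¬ InC p i a
  a∉C a∈C = irreducible {inj₁ a} a∈C
    (a-reducible a⊀b (proj₂ (upper-cover (Le-isPartialOrder p valid) (Le? p) a<b)))

  b∉C : ¬ InC p i b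
  b∉C b∈C = irreducible {inj₁ b} b∈C
    (b-reducible a⊀b (proj₂ (lower-cover (Le-isPartialOrder p valid) (Le? p) a<b)))

mainTheorem14 : ∀ {k} (p : Pres k) → Valid p
    → IsMaximalChain (Le p) (InC p 0)
    → (∀ x → Reducible (Le p) x → InC p 0 x)
    → ∀ i → 1 ≤ i → i ≤ k
    → ∀ d e → IsDim (Le p) d → IsDim (MinusRel p i) e
    → d ≤ suc e
mainTheorem14 p valid _ reducible⇒C₀ i 1≤i i≤k d e (_ , d-minimal) (realizer , _) =
  d-minimal (suc e) (attached-realizer (Le-isPartialOrder p valid) (Le? p) (Car-≟ p)
    (λ x → comp p x ℕ.≟ i) (InC-total p) (chain-attached p valid 1≤i i≤k Cᵢ-irreducible) realizer)
  where
  Cᵢ-irreducible : ∀ {x} → InC p i x → ¬ Reducible (Le p) x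
  Cᵢ-irreducible {x} x∈Cᵢ x-reducible = ℕ.<⇒≢ 1≤i (trans (sym (reducible⇒C₀ x x-reducible)) x∈Cᵢ)
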